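{- Let $\ell\ge1$ and $n$ be integers and let $T$ be an $n$-vertex tree for which $k=k(T)$ is defined. Then every connected card in the $(n-\ell)$-deck of $T$ has diameter at least $2k+2$, and some connected card has diameter at most $2k+3$.
   Context: The $(n-\ell)$-deck of an $n$-vertex graph is the multiset of its induced subgraphs on $n-\ell$ vertices; these are called cards. A $j$-evine is a tree of diameter $2j+1$. For an $n$-vertex tree $T$, $k(T)$ is the largest integer $j\ge0$ such that $T$ contains a subtree that is a $j$-evine and every subtree of $T$ that is a $j$-evine has fewer than $n-\ell$ vertices; $k(T)$ is defined when such $j$ exists. -}

module Defs where

open import Data.Nat using (ℕ; zero; suc; _+_; _*_; _∸_; _≤_; _<_)
open import Data.Bool using (Bool; true; false; T)
open import Data.Fin using (Fin)
open import Data.Fin.Subset using (Subset; _∈_; ⊤; ∣_∣)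
open import Data.List using (List; []; _∷_; length)
open import Data.List.Relation.Unary.All using (All)
open import Data.List.Relation.Unary.Linked using (Linked)
open import Data.List.Relation.Unary.Unique.Propositional using (Unique)
open import Data.Product using (Σ; ∃; _×_; _,_)
open import Relation.Binary.PropositionalEquality using (_≡_)
open import Relation.Nullary using (¬_)

record Graph (n : ℕ) : Set where
  field
    adj    : Fin n → Fin n → Bool
    sym    : ∀ u v → adj u v ≡ adj v u
    irrefl : ∀ u → adj u u ≡ false
open Graph public

Adj : ∀ {n} → Graph n → Fin n → Fin n → Set
Adj G u v = T (adj G u v)

data Walk {n : ℕ} (W : Subset n) (F : Fin n → Fin n → Set)
     : Fin n → Fin n → ℕ → Set where
  nil  : ∀ {u} → u ∈ W → Walk W F u u zero
  cons : ∀ {u w v m} → u ∈ W → F u w → Walk W F w v m → Walk W F u v (suc m)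

Connected : ∀ {n} → Subset n → (Fin n → Fin n → Set) → Set
Connected W F = ∀ u v → u ∈ W → v ∈ W → ∃ λ m → Walk W F u v m

DistAtLeast : ∀ {n} → Subset n → (Fin n → Fin n → Set) → Fin n → Fin n → ℕ → Set
DistAtLeast W F u v d = ∀ m → Walk W F u v m → d ≤ m

DiamAtLeast : ∀ {n} → Subset n → (Fin n → Fin n → Set) → ℕ → Set
DiamAtLeast W F d = ∃ λ u → ∃ λ v → u ∈ W × v ∈ W × DistAtLeast W F u v d

DiamAtMost : ∀ {n} → Subset n → (Fin n → Fin n → Set) → ℕ → Set
DiamAtMost W F d = ∀ u v → u ∈ W → v ∈ W → ∃ λ m → m ≤ d × Walk W F u v m

HasDiameter : ∀ {n} → Subset n → (Fin n → Fin n → Set) → ℕ → Set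
HasDiameter W F d = DiamAtLeast W F d × DiamAtMost W F d

lastOf : ∀ {n} → Fin n → List (Fin n) → Fin n
lastOf c []       = c
lastOf c (d ∷ ds) = lastOf d ds

IsCycle : ∀ {n} → Subset n → (Fin n → Fin n → Set) → Fin n → List (Fin n) → Set
IsCycle W F c cs =
  2 ≤ length cs × Unique (c ∷ cs) × All (_∈ W) (c ∷ cs)
  × Linked F (c ∷ cs) × F (lastOf c cs) c

Acyclic : ∀ {n} → Subset n → (Fin n → Fin n → Set) → Set
Acyclic W F = ∀ c cs → ¬ IsCycle W F c cs

IsTree : ∀ {n} → Subset n → (Fin n → Fin n → Set) → Set
IsTree W F = (∃ λ u → u ∈ W) × Connected W F × Acyclic W F

record IsSubgraph {n : ℕ} (G : Graph n) (W : Subset n) (F : Fin n → Fin n → Set) : Set where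
  field
    edge  : ∀ {u v} → F u v → Adj G u v
    inV   : ∀ {u v} → F u v → u ∈ W
    symm  : ∀ {u v} → F u v → F v u

Induced : ∀ {n} → Graph n → Subset n → Fin n → Fin n → Set
Induced G W u v = u ∈ W × v ∈ W × Adj G u v

IsTreeGraph : ∀ {n} → Graph n → Set
IsTreeGraph G = IsTree ⊤ (Adj G)

EvineSubtree : ∀ {n} → Graph n → ℕ → Subset n → (Fin n → Fin n → Set) → Set
EvineSubtree G j W F = IsSubgraph G W F × IsTree W F × HasDiameter W F (2 * j + 1)

KProp : ∀ {n} → Graph n → ℕ → ℕ → Set₁
KProp {n} G ℓ j =
  (∃ λ W → Σ (Fin n → Fin n → Set) λ F → EvineSubtree G j W F)
  × (∀ W F → EvineSubtree G j W F → ∣ W ∣ < n ∸ ℓ)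

IsK : ∀ {n} → Graph n → ℕ → ℕ → Set₁
IsK G ℓ k = KProp G ℓ k × (∀ j → KProp G ℓ j → j ≤ k)

-- W is the vertex set of a card of the (n-ℓ)-deck
IsCard : ∀ {n} → ℕ → Subset n → Set
IsCard {n} ℓ W = ∣ W ∣ ≡ n ∸ ℓ

-- A connected subgraph of a tree is a subtree whose distances are those of the tree, since any
-- two walks erase to the unique path; and adding a neighbour to a vertex set raises the diameter
-- of the induced subgraph by at most one.  If a card had diameter at most 2k + 1, growing it one
-- neighbour at a time would reach diameter exactly 2k + 1 (or the whole tree, which contains a
-- k-evine), i.e. a k-evine with at least n − ℓ vertices.  If no connected card had diameter at
-- most 2k + 3, then growing from one end of a far pair in a connected card would give a
-- (k + 1)-evine, and every (k + 1)-evine would have fewer than n − ℓ vertices, since a larger one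
-- contains a connected card of no larger diameter; so k + 1 would qualify, against maximality.
module Submission where

open import Defs hiding (sym)
open import Data.Nat using (ℕ; zero; suc; _+_; _*_; _∸_; _≤_; _<_; z≤n; s≤s)
open import Data.Nat.Properties
  using (≤-refl; ≤-trans; ≤-reflexive; ≤-antisym; m≤n⇒m≤1+n; n≤1+n; m≤m+n; m≤n+m; +-suc; +-identityʳ; +-comm
        ; ≰⇒>; <⇒≱; ≮⇒≥; 1+n≰n; m∸n≤m; _<?_)
  renaming (_≟_ to _≟ℕ_)
open import Data.Nat.Tactic.RingSolver using (solve-∀)
open import Data.Bool using (T; T?)
open import Data.Empty using (⊥-elim)
open import Data.Fin using (Fin; zero; suc) renaming (_≟_ to _≟ᶠ_)
open import Data.Fin.Subset using (Subset; _∈_; _∉_; ⊤; _⊆_; _∪_; ⁅_⁆; ∣_∣; inside; outside) renaming (⊥ to ∅)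
open import Data.Fin.Subset.Properties
  using ( ∈⊤; _∈?_; p⊆p∪q; x∈p∪q⁻; x∈⁅x⁆; x∈⁅y⁆⇒x≡y; ∪-identityʳ
        ; p⊆q⇒∣p∣≤∣q∣; ∣p∣≤n; ∣p∣≡n⇒p≡⊤; ∣⁅x⁆∣≡1; ∣⊥∣≡0; ∣⊤∣≡n)
open import Data.Fin.Properties using (any?)
open import Data.List using (List; []; _∷_; length; _++_; _ʳ++_)
open import Data.List.Properties using (length-ʳ++)
open import Data.List.Relation.Unary.Any using (Any; here; there)
open import Data.List.Relation.Unary.All as All using (All; []; _∷_)
open import Data.List.Relation.Unary.All.Properties using (++⁻ˡ; ¬Any⇒All¬)
open import Data.List.Relation.Unary.Linked as Linked using (Linked; []; [-]; _∷_)
open import Data.List.Relation.Unary.AllPairs using ([]; _∷_)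
open import Data.List.Relation.Unary.Unique.Propositional using (Unique)
open import Data.List.Relation.Unary.Unique.Propositional.Properties using () renaming (++⁺ to Unique-++⁺)
open import Data.List.Relation.Binary.Disjoint.Propositional using (Disjoint)
open import Data.List.Relation.Binary.Permutation.Propositional using (↭⇒↭ₛ; prep)
open import Data.List.Relation.Binary.Permutation.Propositional.Properties using (++↭ʳ++)
import Data.List.Relation.Binary.Permutation.Setoid.Properties as Permutation
open import Data.List.Membership.Propositional using (lose) renaming (_∈_ to _∈ₗ_)
open import Data.List.Membership.Propositional.Properties using (∈-insert; ∈-∃++; ∈-++⁺ˡ)
import Data.List.Membership.DecPropositional as DecMembership
open import Data.Product as Product using (Σ; ∃; _×_; _,_; proj₁; proj₂)
open import Relation.Binary.Core using (_⇒_)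
open import Relation.Binary.Definitions using (Symmetric)
open import Relation.Binary.PropositionalEquality
  using (_≡_; _≢_; refl; sym; trans; cong; subst; subst₂; setoid)
open import Relation.Nullary using (¬_; Dec; yes; no)
open import Relation.Nullary.Decidable using (_×-dec_; ¬?; decidable-stable)
open import Data.Sum using (_⊎_; inj₁; inj₂)
open import Data.Vec using ([]; _∷_; here; there)
open import Function using (_∘_; id)

Rel : ℕ → Set₁
Rel n = Fin n → Fin n → Set

_∈ₗ?_ : ∀ {n} (x : Fin n) xs → Dec (x ∈ₗ xs)
_∈ₗ?_ {n} = DecMembership._∈?_ (_≟ᶠ_ {n})

adj-sym : ∀ {n} (G : Graph n) → Symmetric (Adj G)
adj-sym G {a} {b} = subst T (Graph.sym G a b)

split-at-first : ∀ {A : Set} {P : A → Set} → (∀ z → Dec (P z)) → ∀ xs → Any P xs →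
  ∃ λ bs → ∃ λ c → ∃ λ rest → xs ≡ bs ++ c ∷ rest × All (λ z → ¬ P z) bs × P c
split-at-first P? (x ∷ xs) x∈ with P? x
... | yes px = [] , x , xs , refl , [] , px
split-at-first P? (x ∷ xs) (here px) | no ¬px = ⊥-elim (¬px px)
split-at-first P? (x ∷ xs) (there a) | no ¬px with split-at-first P? xs a
... | bs , c , rest , xs≡ , ¬pbs , pc = x ∷ bs , c , rest , cong (x ∷_) xs≡ , ¬px ∷ ¬pbs , pc

Unique-++-∷⇒Unique-∷ : ∀ {A : Set} (bs : List A) {c rest} → Unique (bs ++ c ∷ rest) → Unique (c ∷ bs)
Unique-++-∷⇒Unique-∷ []       _            = [] ∷ []
Unique-++-∷⇒Unique-∷ (b ∷ bs) {c} (b∉ ∷ uniq) with Unique-++-∷⇒Unique-∷ bs uniq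
... | c∉bs ∷ unique-bs = (c≢b ∷ c∉bs) ∷ (++⁻ˡ bs b∉ ∷ unique-bs)
  where
  c≢b : c ≢ b
  c≢b c≡b = All.lookup b∉ (∈-insert bs) (sym c≡b)

module _ {n : ℕ} where

  lastOf-∈ : ∀ (c : Fin n) cs → lastOf c cs ∈ₗ c ∷ cs
  lastOf-∈ c []       = here refl
  lastOf-∈ c (d ∷ ds) = there (lastOf-∈ d ds)

  lastOf-ʳ++ : ∀ {c} a (ms acc : List (Fin n)) → lastOf c (ms ʳ++ a ∷ acc) ≡ lastOf a acc
  lastOf-ʳ++ a []       acc = refl
  lastOf-ʳ++ a (m ∷ ms) acc = lastOf-ʳ++ m ms (a ∷ acc)

  Linked-ʳ++ : ∀ {F : Rel n} → Symmetric F → ∀ {c a} ms acc →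
    Linked F (a ∷ ms) → F c (lastOf a ms) → Linked F (a ∷ acc) → Linked F (c ∷ ms ʳ++ a ∷ acc)
  Linked-ʳ++ F-sym []       acc _         c~ l = c~ ∷ l
  Linked-ʳ++ F-sym {a = a} (m ∷ ms) acc (a~m ∷ lm) c~ l = Linked-ʳ++ F-sym ms (a ∷ acc) lm c~ (F-sym a~m ∷ l)

  Linked-++-∷⁻ : ∀ {F : Rel n} u bs {c rest} → Linked F (u ∷ bs ++ c ∷ rest) →
    Linked F (u ∷ bs) × F (lastOf u bs) c
  Linked-++-∷⁻ u []       (u~c ∷ _) = [-] , u~c
  Linked-++-∷⁻ u (b ∷ bs) (u~b ∷ l) = Product.map₁ (u~b ∷_) (Linked-++-∷⁻ b bs l)

module _ {n : ℕ} {F : Rel n} (F-sym : Symmetric F) where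

  disjoint-paths⇒cycle : ∀ {u c} bs qs → 1 ≤ length bs + length qs →
    Linked F (u ∷ bs) → F (lastOf u bs) c → Linked F (u ∷ qs) → F (lastOf u qs) c →
    Unique (c ∷ u ∷ bs) → Unique (c ∷ u ∷ qs) → Disjoint bs qs →
    IsCycle ⊤ F c (bs ʳ++ u ∷ qs)
  disjoint-paths⇒cycle {u} {c} bs qs nontrivial lb b~c lq q~c
                       ((c≢u ∷ c∉bs) ∷ (u∉bs ∷ unique-bs)) ((_ ∷ c∉qs) ∷ unique-uqs) bs∩qs=∅ =
    long , distinct , All.tabulate (λ _ → ∈⊤) , Linked-ʳ++ F-sym bs qs lb (F-sym b~c) lq , closing
    where
    long : 2 ≤ length (bs ʳ++ u ∷ qs)
    long = subst (2 ≤_) (sym (trans (length-ʳ++ bs) (+-suc _ _))) (s≤s nontrivial)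
    disjoint : Disjoint (c ∷ bs) (u ∷ qs)
    disjoint (here refl   , here z≡u)   = c≢u z≡u
    disjoint (here refl   , there z∈qs) = All.lookup c∉qs z∈qs refl
    disjoint (there z∈bs  , here refl)  = All.lookup u∉bs z∈bs refl
    disjoint (there z∈bs  , there z∈qs) = bs∩qs=∅ (z∈bs , z∈qs)
    distinct : Unique (c ∷ bs ʳ++ u ∷ qs)
    distinct = Permutation.Unique-resp-↭ (setoid (Fin n)) (↭⇒↭ₛ (prep c (++↭ʳ++ bs (u ∷ qs))))
                 (Unique-++⁺ (c∉bs ∷ unique-bs) unique-uqs disjoint)
    closing : F (lastOf c (bs ʳ++ u ∷ qs)) c
    closing = subst (λ z → F z c) (sym (lastOf-ʳ++ u bs qs)) q~c

  -- The first vertex c of one path lying on the other closes a cycle through u.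
  diverging-paths⇒distinct-ends : Acyclic ⊤ F → ∀ {u x y} xs ys → x ≢ y →
    Linked F (u ∷ x ∷ xs) → Unique (u ∷ x ∷ xs) → Linked F (u ∷ y ∷ ys) → Unique (u ∷ y ∷ ys) →
    lastOf x xs ≢ lastOf y ys
  diverging-paths⇒distinct-ends acyclic {u} {x} {y} xs ys x≢y lx ux ly uy same-end
    with split-at-first (_∈ₗ? (y ∷ ys)) (x ∷ xs)
           (lose (lastOf-∈ x xs) (subst (_∈ₗ y ∷ ys) (sym same-end) (lastOf-∈ y ys)))
  ... | bs , c , rest , xs≡ , bs∉ys , c∈ys with ∈-∃++ c∈ys
  ... | qs , rest′ , ys≡
    with Linked-++-∷⁻ u bs (subst (λ L → Linked F (u ∷ L)) xs≡ lx)
       | Linked-++-∷⁻ u qs (subst (λ L → Linked F (u ∷ L)) ys≡ ly)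
  ... | lb , b~c | lq , q~c =
    acyclic c (bs ʳ++ u ∷ qs)
      (disjoint-paths⇒cycle bs qs (nontrivial bs qs xs≡ ys≡) lb b~c lq q~c
         (Unique-++-∷⇒Unique-∷ (u ∷ bs) (subst (λ L → Unique (u ∷ L)) xs≡ ux))
         (Unique-++-∷⇒Unique-∷ (u ∷ qs) (subst (λ L → Unique (u ∷ L)) ys≡ uy))
         (λ (z∈bs , z∈qs) → All.lookup bs∉ys z∈bs (subst (_ ∈ₗ_) (sym ys≡) (∈-++⁺ˡ z∈qs))))
    where
    nontrivial : ∀ bs qs → x ∷ xs ≡ bs ++ c ∷ rest → y ∷ ys ≡ qs ++ c ∷ rest′ → 1 ≤ length bs + length qs
    nontrivial (_ ∷ _) _       _    _    = s≤s z≤n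
    nontrivial []      (_ ∷ _) _    _    = s≤s z≤n
    nontrivial []      []      refl refl = ⊥-elim (x≢y refl)

  paths-same-length : Acyclic ⊤ F → ∀ u xs ys →
    Linked F (u ∷ xs) → Unique (u ∷ xs) → Linked F (u ∷ ys) → Unique (u ∷ ys) →
    lastOf u xs ≡ lastOf u ys → length xs ≡ length ys
  paths-same-length acyclic u [] [] _ _ _ _ _ = refl
  paths-same-length acyclic u [] (y ∷ ys) _ _ _ (u∉ ∷ _) u≡ =
    ⊥-elim (All.lookup u∉ (subst (_∈ₗ y ∷ ys) (sym u≡) (lastOf-∈ y ys)) refl)
  paths-same-length acyclic u (x ∷ xs) [] _ (u∉ ∷ _) _ _ ≡u =
    ⊥-elim (All.lookup u∉ (subst (_∈ₗ x ∷ xs) ≡u (lastOf-∈ x xs)) refl)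
  paths-same-length acyclic u (x ∷ xs) (y ∷ ys) lx@(_ ∷ lx′) ux@(_ ∷ ux′) ly@(_ ∷ ly′) uy@(_ ∷ uy′) same-end
    with x ≟ᶠ y
  ... | yes refl = cong suc (paths-same-length acyclic x xs ys lx′ ux′ ly′ uy′ same-end)
  ... | no x≢y   = ⊥-elim (diverging-paths⇒distinct-ends acyclic xs ys x≢y lx ux ly uy same-end)

module _ {n : ℕ} where

  walk-map : ∀ {W W′ : Subset n} {F F′ : Rel n} {u v m} → W ⊆ W′ → F ⇒ F′ → Walk W F u v m → Walk W′ F′ u v m
  walk-map W⊆W′ F⇒F′ (nil uW)       = nil (W⊆W′ uW)
  walk-map W⊆W′ F⇒F′ (cons uW u~w w) = cons (W⊆W′ uW) (F⇒F′ u~w) (walk-map W⊆W′ F⇒F′ w)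

  walk-start : ∀ {W : Subset n} {F u v m} → Walk W F u v m → u ∈ W
  walk-start (nil uW)     = uW
  walk-start (cons uW _ _) = uW

  walk-snoc : ∀ {W : Subset n} {F u v x m} → Walk W F u v m → F v x → x ∈ W → Walk W F u x (suc m)
  walk-snoc (nil uW)        v~x xW = cons uW v~x (nil xW)
  walk-snoc (cons uW u~w w) v~x xW = cons uW u~w (walk-snoc w v~x xW)

  walk-exit : ∀ {W S : Subset n} {F u v m} → Walk W F u v m → u ∈ S → v ∉ S →
    ∃ λ a → ∃ λ x → a ∈ S × x ∉ S × F a x × x ∈ W
  walk-exit (nil _) uS vS = ⊥-elim (vS uS)
  walk-exit {S = S} (cons {w = x} _ u~x w) uS vS with x ∈? S
  ... | yes xS = walk-exit w xS vS
  ... | no  xS = _ , x , uS , xS , u~x , walk-start w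

  diamAtMost⇒connected : ∀ {W : Subset n} {F d} → DiamAtMost W F d → Connected W F
  diamAtMost⇒connected diam u v uW vW = Product.map₂ proj₂ (diam u v uW vW)

record Path {n : ℕ} (W : Subset n) (F : Rel n) (u v : Fin n) : Set where
  field
    steps    : List (Fin n)
    linked   : Linked F (u ∷ steps)
    within   : All (_∈ W) (u ∷ steps)
    distinct : Unique (u ∷ steps)
    ends     : lastOf u steps ≡ v

  len : ℕ
  len = length steps

open Path

module _ {n : ℕ} {W : Subset n} {F : Rel n} where
  path⇒walk : ∀ {u v} (p : Path W F u v) → Walk W F u v (len p)
  path⇒walk {u} p =
    subst (λ v → Walk W F u v (len p)) (ends p) (vertices⇒walk u (steps p) (linked p) (within p))
    where
    vertices⇒walk : ∀ u xs → Linked F (u ∷ xs) → All (_∈ W) (u ∷ xs) →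
      Walk W F u (lastOf u xs) (length xs)
    vertices⇒walk u []       _          (uW ∷ []) = nil uW
    vertices⇒walk u (x ∷ xs) (u~x ∷ l) (uW ∷ a)  = cons uW u~x (vertices⇒walk x xs l a)

  path-suffix : ∀ {u x v} (p : Path W F x v) → u ∈ₗ x ∷ steps p → Σ (Path W F u v) λ q → len q ≤ len p
  path-suffix p (here refl) = p , ≤-refl
  path-suffix record { steps = _ ∷ ys ; linked = _ ∷ l ; within = _ ∷ a ; distinct = _ ∷ d ; ends = e }
              (there u∈) =
    Product.map₂ m≤n⇒m≤1+n
      (path-suffix record { steps = ys ; linked = l ; within = a ; distinct = d ; ends = e } u∈)

  walk⇒path : ∀ {u v m} → Walk W F u v m → Σ (Path W F u v) λ p → len p ≤ m
  walk⇒path (nil uW) =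
    record { steps = [] ; linked = [-] ; within = uW ∷ [] ; distinct = [] ∷ [] ; ends = refl } , z≤n
  walk⇒path {u} (cons {w = x} uW u~x w) with walk⇒path w
  ... | p , p≤m with u ∈ₗ? (x ∷ steps p)
  ...   | yes u∈p = Product.map₂ (λ q≤p → m≤n⇒m≤1+n (≤-trans q≤p p≤m)) (path-suffix p u∈p)
  ...   | no  u∉p = record { steps = x ∷ steps p ; linked = u~x ∷ linked p ; within = uW ∷ within p
                           ; distinct = ¬Any⇒All¬ _ u∉p ∷ distinct p ; ends = ends p } , s≤s p≤m

path-map : ∀ {n} {W W′ : Subset n} {F F′ : Rel n} {u v} → W ⊆ W′ → F ⇒ F′ → Path W F u v → Path W′ F′ u v
path-map W⊆W′ F⇒F′ p = record
  { steps = steps p ; linked = Linked.map F⇒F′ (linked p) ; within = All.map W⊆W′ (within p)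
  ; distinct = distinct p ; ends = ends p }

path-length-unique : ∀ {n} {W : Subset n} {F : Rel n} → Symmetric F → Acyclic ⊤ F →
  ∀ {u v} (p q : Path W F u v) → len p ≡ len q
path-length-unique F-sym acyclic {u} p q =
  paths-same-length F-sym acyclic u (steps p) (steps q) (linked p) (distinct p) (linked q) (distinct q)
    (trans (ends p) (sym (ends q)))

module _ {n : ℕ} (G : Graph n) (acyclic : Acyclic ⊤ (Adj G)) where

  walk-shortcut : ∀ {W W′ : Subset n} {R R′ : Rel n} {u v m} → R ⇒ Adj G → Connected W R →
    u ∈ W → v ∈ W → R′ ⇒ Adj G → Walk W′ R′ u v m → ∃ λ m′ → m′ ≤ m × Walk W R u v m′
  walk-shortcut R⊆G connected uW vW R′⊆G w with walk⇒path w | connected _ _ uW vW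
  ... | p , p≤m | _ , w′ with walk⇒path w′
  ... | q , _ = len q , ≤-trans (≤-reflexive (sym p≡q)) p≤m , path⇒walk q
    where
    p≡q : len p ≡ len q
    p≡q = path-length-unique (adj-sym G) acyclic (path-map (λ _ → ∈⊤) R′⊆G p) (path-map (λ _ → ∈⊤) R⊆G q)

  distAtLeast-transfer : ∀ {W W′ : Subset n} {R R′ : Rel n} {u v d} → R ⇒ Adj G → Connected W R →
    u ∈ W → v ∈ W → DistAtLeast W R u v d → R′ ⇒ Adj G → DistAtLeast W′ R′ u v d
  distAtLeast-transfer R⊆G connected uW vW dist R′⊆G m w with walk-shortcut R⊆G connected uW vW R′⊆G w
  ... | m′ , m′≤m , w′ = ≤-trans (dist m′ w′) m′≤m

  diamAtMost-transfer : ∀ {W W′ : Subset n} {R R′ : Rel n} {d} → R ⇒ Adj G → Connected W R →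
    W ⊆ W′ → R′ ⇒ Adj G → DiamAtMost W′ R′ d → DiamAtMost W R d
  diamAtMost-transfer R⊆G connected W⊆W′ R′⊆G diam u v uW vW with diam u v (W⊆W′ uW) (W⊆W′ vW)
  ... | m , m≤d , w with walk-shortcut R⊆G connected uW vW R′⊆G w
  ...   | m′ , m′≤m , w′ = m′ , ≤-trans m′≤m m≤d , w′

BoundedWalk : ∀ {n} → Subset n → Rel n → ℕ → Fin n → Fin n → Set
BoundedWalk W F d u v = ∃ λ m → m ≤ d × Walk W F u v m

module _ {n : ℕ} {W : Subset n} {F : Rel n} (F? : ∀ a b → Dec (F a b)) where

  boundedWalk? : ∀ d u v → Dec (BoundedWalk W F d u v)
  boundedWalk? zero u v with u ∈? W | u ≟ᶠ v
  ... | yes uW  | yes refl = yes (0 , z≤n , nil uW)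
  ... | no  uW∉ | _        = no λ { (0 , _ , nil uW) → uW∉ uW }
  ... | yes _   | no  u≢v  = no λ { (0 , _ , nil _) → u≢v refl }
  boundedWalk? (suc d) u v
    with boundedWalk? zero u v | any? (λ x → (u ∈? W) ×-dec F? u x ×-dec boundedWalk? d x v)
  ... | yes (_ , z≤n , w) | _ = yes (0 , z≤n , w)
  ... | no _ | yes (x , uW , u~x , m , m≤d , w) = yes (suc m , s≤s m≤d , cons uW u~x w)
  ... | no ¬stay | no ¬step = no λ
    { (zero , _ , w)                     → ¬stay (0 , z≤n , w)
    ; (suc m , s≤s m≤d , cons uW u~x w) → ¬step (_ , uW , u~x , m , m≤d , w) }

  diamAtLeast⊎diamAtMost : ∀ d → DiamAtLeast W F (suc d) ⊎ DiamAtMost W F d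
  diamAtLeast⊎diamAtMost d
    with any? (λ u → any? (λ v → (u ∈? W) ×-dec (v ∈? W) ×-dec ¬? (boundedWalk? d u v)))
  ... | yes (u , v , uW , vW , far) = inj₁ (u , v , uW , vW , λ m w → ≰⇒> λ m≤d → far (m , m≤d , w))
  ... | no ¬far = inj₂ λ u v uW vW →
    decidable-stable (boundedWalk? d u v) λ ¬near → ¬far (u , v , uW , vW , ¬near)

  diamAtMost? : ∀ d → Dec (DiamAtMost W F d)
  diamAtMost? d with diamAtLeast⊎diamAtMost d
  ... | inj₂ near = yes near
  ... | inj₁ (u , v , uW , vW , far) = no λ near → let (m , m≤d , w) = near u v uW vW in <⇒≱ (far m w) m≤d

induced? : ∀ {n} (G : Graph n) S → ∀ a b → Dec (Induced G S a b)
induced? G S a b = (a ∈? S) ×-dec (b ∈? S) ×-dec T? (adj G a b)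

∣p∪⁅x⁆∣≡1+∣p∣ : ∀ {n} (p : Subset n) (x : Fin n) → x ∉ p → ∣ p ∪ ⁅ x ⁆ ∣ ≡ suc ∣ p ∣
∣p∪⁅x⁆∣≡1+∣p∣         (inside  ∷ p) zero    x∉p = ⊥-elim (x∉p here)
∣p∪⁅x⁆∣≡1+∣p∣ {suc n} (outside ∷ p) zero    x∉p = cong (suc ∘ ∣_∣) (∪-identityʳ p)
∣p∪⁅x⁆∣≡1+∣p∣         (inside  ∷ p) (suc x) x∉p = cong suc (∣p∪⁅x⁆∣≡1+∣p∣ p x (x∉p ∘ there))
∣p∪⁅x⁆∣≡1+∣p∣         (outside ∷ p) (suc x) x∉p = ∣p∪⁅x⁆∣≡1+∣p∣ p x (x∉p ∘ there)

∣p∣<∣q∣⇒∃∈q∉p : ∀ {n} (p q : Subset n) → ∣ p ∣ < ∣ q ∣ → ∃ λ x → x ∈ q × x ∉ p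
∣p∣<∣q∣⇒∃∈q∉p p q ∣p∣<∣q∣ with any? (λ x → (x ∈? q) ×-dec ¬? (x ∈? p))
... | yes new = new
... | no ¬new = ⊥-elim (<⇒≱ ∣p∣<∣q∣ (p⊆q⇒∣p∣≤∣q∣ q⊆p))
  where
  q⊆p : q ⊆ p
  q⊆p {x} x∈q = decidable-stable (x ∈? p) λ x∉p → ¬new (x , x∈q , x∉p)

∣p∣+1+f≡∣p∪⁅x⁆∣+f : ∀ {n f} (p : Subset n) {x} → x ∉ p → ∣ p ∣ + suc f ≡ ∣ p ∪ ⁅ x ⁆ ∣ + f
∣p∣+1+f≡∣p∪⁅x⁆∣+f {f = f} p {x} x∉p = trans (+-suc ∣ p ∣ f) (cong (_+ f) (sym (∣p∪⁅x⁆∣≡1+∣p∣ p x x∉p)))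

anySubset? : ∀ {n} {P : Subset n → Set} → (∀ S → Dec (P S)) → Dec (∃ P)
anySubset? {zero} P? with P? []
... | yes p = yes ([] , p)
... | no ¬p = no λ { ([] , p) → ¬p p }
anySubset? {suc n} P? with anySubset? (P? ∘ (inside ∷_)) | anySubset? (P? ∘ (outside ∷_))
... | yes (S , p) | _           = yes (inside ∷ S , p)
... | no _        | yes (S , p) = yes (outside ∷ S , p)
... | no ¬in      | no ¬out     = no λ { (inside ∷ S , p) → ¬in (S , p) ; (outside ∷ S , p) → ¬out (S , p) }

module _ {n : ℕ} (G : Graph n) where

  induced⇒adj : ∀ {S : Subset n} → Induced G S ⇒ Adj G
  induced⇒adj (_ , _ , a~b) = a~b

  induced-isSubgraph : ∀ S → IsSubgraph G S (Induced G S)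
  induced-isSubgraph S = record
    { edge = induced⇒adj ; inV = proj₁ ; symm = λ (aS , bS , a~b) → bS , aS , adj-sym G a~b }

  induced-mono : ∀ {S S′ : Subset n} → S ⊆ S′ → Induced G S ⇒ Induced G S′
  induced-mono S⊆S′ (aS , bS , a~b) = S⊆S′ aS , S⊆S′ bS , a~b

  diamAtMost-singleton : ∀ a d → DiamAtMost ⁅ a ⁆ (Induced G ⁅ a ⁆) d
  diamAtMost-singleton a d u v u∈ v∈ with x∈⁅y⁆⇒x≡y a u∈ | x∈⁅y⁆⇒x≡y a v∈
  ... | refl | refl = 0 , z≤n , nil u∈

  private
    extend-walk : ∀ {S : Subset n} x {u v m} → Walk S (Induced G S) u v m →
      Walk (S ∪ ⁅ x ⁆) (Induced G (S ∪ ⁅ x ⁆)) u v m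
    extend-walk x = walk-map (p⊆p∪q ⁅ x ⁆) (induced-mono (p⊆p∪q ⁅ x ⁆))

  diamAtMost-extend : ∀ {S x y d} → y ∈ S → Adj G y x → DiamAtMost S (Induced G S) d →
    DiamAtMost (S ∪ ⁅ x ⁆) (Induced G (S ∪ ⁅ x ⁆)) (suc d)
  diamAtMost-extend {S} {x} {y} yS y~x diam a b a∈ b∈ with x∈p∪q⁻ S ⁅ x ⁆ a∈ | x∈p∪q⁻ S ⁅ x ⁆ b∈
  ... | inj₁ aS | inj₁ bS =
    let m , m≤d , w = diam a b aS bS in m , m≤n⇒m≤1+n m≤d , extend-walk x w
  ... | inj₂ a∈x | inj₁ bS with refl ← x∈⁅y⁆⇒x≡y x a∈x =
    let m , m≤d , w = diam y b yS bS
    in  suc m , s≤s m≤d , cons a∈ (a∈ , p⊆p∪q ⁅ x ⁆ yS , adj-sym G y~x) (extend-walk x w)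
  ... | inj₁ aS | inj₂ b∈x with refl ← x∈⁅y⁆⇒x≡y x b∈x =
    let m , m≤d , w = diam a y aS yS
    in  suc m , s≤s m≤d , walk-snoc (extend-walk x w) (p⊆p∪q ⁅ x ⁆ yS , b∈ , y~x) b∈
  ... | inj₂ a∈x | inj₂ b∈x with refl ← x∈⁅y⁆⇒x≡y x a∈x | refl ← x∈⁅y⁆⇒x≡y x b∈x = 0 , z≤n , nil a∈

  grow-to-diameter : Connected ⊤ (Adj G) → ∀ e {S s} → s ∈ S → DiamAtMost S (Induced G S) (suc e) →
    ∃ λ S′ → S ⊆ S′ × DiamAtMost S′ (Induced G S′) (suc e)
           × (DiamAtLeast S′ (Induced G S′) (suc e) ⊎ (∀ z → z ∈ S′))
  grow-to-diameter connected e sS diam = grow n (m≤n+m n _) sS diam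
    where
    grow : ∀ fuel {S s} → n ≤ ∣ S ∣ + fuel → s ∈ S → DiamAtMost S (Induced G S) (suc e) →
      ∃ λ S′ → S ⊆ S′ × DiamAtMost S′ (Induced G S′) (suc e)
             × (DiamAtLeast S′ (Induced G S′) (suc e) ⊎ (∀ z → z ∈ S′))
    grow zero {S} n≤∣S∣ _ diam = S , id , diam , inj₂ λ z → subst (z ∈_) (sym S≡⊤) ∈⊤
      where
      S≡⊤ : S ≡ ⊤
      S≡⊤ = ∣p∣≡n⇒p≡⊤ (≤-antisym (∣p∣≤n S) (subst (n ≤_) (+-identityʳ _) n≤∣S∣))
    grow (suc fuel) {S} {s} bound sS diam with diamAtLeast⊎diamAtMost (induced? G S) e
    ... | inj₁ far = S , id , diam , inj₁ far
    ... | inj₂ near with any? (λ z → ¬? (z ∈? S))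
    ...   | no ¬missing = S , id , diam , inj₂ λ z → decidable-stable (z ∈? S) λ z∉S → ¬missing (z , z∉S)
    ...   | yes (w , w∉S) with walk-exit {S = S} (proj₂ (connected s w ∈⊤ ∈⊤)) sS w∉S
    ...     | y , x , yS , x∉S , y~x , _
      with grow fuel (subst (n ≤_) (∣p∣+1+f≡∣p∪⁅x⁆∣+f S x∉S) bound) (p⊆p∪q ⁅ x ⁆ sS)
                (diamAtMost-extend yS y~x near)
    ...       | S′ , S∪x⊆S′ , result = S′ , S∪x⊆S′ ∘ p⊆p∪q ⁅ x ⁆ , result

  grow-within : ∀ {W : Subset n} {R} → R ⇒ Adj G → Connected W R →
    ∀ f {S s d} → S ⊆ W → s ∈ S → DiamAtMost S (Induced G S) d → ∣ S ∣ + f ≤ ∣ W ∣ →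
    ∃ λ S′ → S′ ⊆ W × ∣ S′ ∣ ≡ ∣ S ∣ + f × DiamAtMost S′ (Induced G S′) (d + f)
  grow-within R⊆G connected zero {S} {d = d} S⊆W _ diam _ =
    S , S⊆W , sym (+-identityʳ _) , subst (DiamAtMost S (Induced G S)) (sym (+-identityʳ d)) diam
  grow-within {W} R⊆G connected (suc f) {S} {s} {d} S⊆W sS diam bound
    with ∣p∣<∣q∣⇒∃∈q∉p S W (≤-trans (s≤s (m≤m+n _ f)) (subst (_≤ ∣ W ∣) (+-suc _ f) bound))
  ... | w , wW , w∉S with walk-exit {S = S} (proj₂ (connected s w (S⊆W sS) wW)) sS w∉S
  ... | y , x , yS , x∉S , y~x , xW
    with grow-within R⊆G connected f S∪x⊆W (p⊆p∪q ⁅ x ⁆ sS) (diamAtMost-extend yS (R⊆G y~x) diam)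
           (subst (_≤ ∣ W ∣) (∣p∣+1+f≡∣p∪⁅x⁆∣+f S x∉S) bound)
    where
    S∪x⊆W : S ∪ ⁅ x ⁆ ⊆ W
    S∪x⊆W z∈ with x∈p∪q⁻ S ⁅ x ⁆ z∈
    ... | inj₁ zS  = S⊆W zS
    ... | inj₂ z∈x = subst (_∈ W) (sym (x∈⁅y⁆⇒x≡y x z∈x)) xW
  ... | S′ , S′⊆W , size , diam′ =
    S′ , S′⊆W , trans size (sym (∣p∣+1+f≡∣p∪⁅x⁆∣+f S x∉S)) , subst (DiamAtMost S′ _) (sym (+-suc d f)) diam′

  connected-subset-of-size : ∀ {W : Subset n} {R a} → R ⇒ Adj G → Connected W R → a ∈ W →
    ∀ c → 1 ≤ c → c ≤ ∣ W ∣ → ∃ λ S → S ⊆ W × ∣ S ∣ ≡ c × Connected S (Induced G S)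
  connected-subset-of-size {W} {a = a} R⊆G connected aW (suc f) _ c≤∣W∣
    with grow-within R⊆G connected f ⁅a⁆⊆W (x∈⁅x⁆ a) (diamAtMost-singleton a 0)
           (subst (_≤ ∣ W ∣) (cong (_+ f) (sym (∣⁅x⁆∣≡1 a))) c≤∣W∣)
    where
    ⁅a⁆⊆W : ⁅ a ⁆ ⊆ W
    ⁅a⁆⊆W z∈ = subst (_∈ W) (sym (x∈⁅y⁆⇒x≡y a z∈)) aW
  ... | S , S⊆W , size , diam = S , S⊆W , trans size (cong (_+ f) (∣⁅x⁆∣≡1 a)) , diamAtMost⇒connected diam

module _ {n : ℕ} (G : Graph n) (acyclic : Acyclic ⊤ (Adj G)) where

  induced-acyclic : ∀ S → Acyclic S (Induced G S)
  induced-acyclic S c cs (long , distinct , _ , linked , closing) =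
    acyclic c cs ( long , distinct , All.tabulate (λ _ → ∈⊤)
                 , Linked.map (induced⇒adj G) linked , induced⇒adj G closing)

  diameter⇒evine : ∀ {S j} → HasDiameter S (Induced G S) (2 * j + 1) → EvineSubtree G j S (Induced G S)
  diameter⇒evine {S} diam@((u , _ , uS , _) , near) =
    induced-isSubgraph G S , ((u , uS) , diamAtMost⇒connected near , induced-acyclic S) , diam

  -- If the whole graph is swallowed, the far pair a, b certifies diameter at least 2j + 1.
  grow-to-evine : Connected ⊤ (Adj G) → ∀ {j W R a b} → R ⇒ Adj G → Connected W R →
    a ∈ W → b ∈ W → DistAtLeast W R a b (2 * j + 1) →
    ∀ {S s} → s ∈ S → DiamAtMost S (Induced G S) (2 * j + 1) →
    ∃ λ S′ → S ⊆ S′ × EvineSubtree G j S′ (Induced G S′)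
  grow-to-evine connected {j} R⊆G W-connected aW bW far sS near
    with grow-to-diameter G connected (2 * j) sS (subst (DiamAtMost _ _) (+-comm (2 * j) 1) near)
  ... | S′ , S⊆S′ , near′ , reached =
    S′ , S⊆S′ , diameter⇒evine {j = j} (far′ reached , subst (DiamAtMost S′ _) (+-comm 1 (2 * j)) near′)
    where
    far′ : DiamAtLeast S′ (Induced G S′) (suc (2 * j)) ⊎ (∀ z → z ∈ S′) →
           DiamAtLeast S′ (Induced G S′) (2 * j + 1)
    far′ (inj₁ far″) = subst (DiamAtLeast S′ _) (+-comm 1 (2 * j)) far″
    far′ (inj₂ full) =
      _ , _ , full _ , full _ , distAtLeast-transfer G acyclic R⊆G W-connected aW bW far (induced⇒adj G)

2[1+k]+1≡2k+3 : ∀ k → 2 * suc k + 1 ≡ 2 * k + 3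
2[1+k]+1≡2k+3 = solve-∀

module _ {n : ℕ} (ℓ : ℕ) {T : Graph n} (tree : IsTreeGraph T) where
  private
    connected : Connected ⊤ (Adj T)
    connected = proj₁ (proj₂ tree)
    acyclic : Acyclic ⊤ (Adj T)
    acyclic = proj₂ (proj₂ tree)

  KProp⇒1≤n∸ℓ : ∀ {k} → KProp T ℓ k → 1 ≤ n ∸ ℓ
  KProp⇒1≤n∸ℓ ((E , F , evine) , small) = ≤-trans (s≤s z≤n) (small E F evine)

  cards-diamAtLeast : ∀ {k} → KProp T ℓ k → ∀ W → IsCard ℓ W → DiamAtLeast W (Induced T W) (2 * k + 2)
  cards-diamAtLeast {k} k-prop@((E , F , subE , (_ , E-connected , _) , (a , b , aE , bE , far) , _) , small)
                    W card
    with diamAtLeast⊎diamAtMost (induced? T W) (2 * k + 1)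
  ... | inj₁ far′ = subst (DiamAtLeast W (Induced T W)) (sym (+-suc (2 * k) 1)) far′
  ... | inj₂ near
    with ∣p∣<∣q∣⇒∃∈q∉p ∅ W (subst₂ _<_ (sym (∣⊥∣≡0 n)) (sym card) (KProp⇒1≤n∸ℓ {k = k} k-prop))
  ... | s , sW , _
    with grow-to-evine T acyclic connected {j = k} (IsSubgraph.edge subE) E-connected aE bE far sW near
  ... | S , W⊆S , evine = ⊥-elim (<⇒≱ (small S _ evine) (subst (_≤ ∣ S ∣) card (p⊆q⇒∣p∣≤∣q∣ W⊆S)))

  module _ {k : ℕ} (pos : 1 ≤ n ∸ ℓ)
           (none : ¬ ∃ λ W → IsCard ℓ W × DiamAtMost W (Induced T W) (2 * k + 3)) where

    next-evine-exists : ∃ λ W → Σ (Rel n) λ F → EvineSubtree T (suc k) W F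
    next-evine-exists
      with connected-subset-of-size T id connected (proj₂ (proj₁ tree)) (n ∸ ℓ) pos
             (subst (n ∸ ℓ ≤_) (sym (∣⊤∣≡n n)) (m∸n≤m n ℓ))
    ... | S , _ , card , S-connected with diamAtLeast⊎diamAtMost (induced? T S) (2 * k + 3)
    ... | inj₂ near = ⊥-elim (none (S , card , near))
    ... | inj₁ (a , b , aS , bS , far)
      with grow-to-evine T acyclic connected {j = suc k} (induced⇒adj T) S-connected aS bS far′
             (x∈⁅x⁆ a) (diamAtMost-singleton T a _)
      where
      far′ : DistAtLeast S (Induced T S) a b (2 * suc k + 1)
      far′ m w = ≤-trans (≤-reflexive (2[1+k]+1≡2k+3 k)) (≤-trans (n≤1+n _) (far m w))
    ... | S′ , _ , evine = S′ , Induced T S′ , evine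

    next-evines-small : ∀ W F → EvineSubtree T (suc k) W F → ∣ W ∣ < n ∸ ℓ
    next-evines-small W F (sub , ((a , aW) , W-connected , _) , _ , near) with ∣ W ∣ <? n ∸ ℓ
    ... | yes small = small
    ... | no ¬small
      with connected-subset-of-size T (IsSubgraph.edge sub) W-connected aW (n ∸ ℓ) pos (≮⇒≥ ¬small)
    ... | S , S⊆W , card , S-connected =
      ⊥-elim (none (S , card , diamAtMost-transfer T acyclic (induced⇒adj T) S-connected S⊆W
                                 (IsSubgraph.edge sub) (subst (DiamAtMost W F) (2[1+k]+1≡2k+3 k) near)))

  connected-card-diamAtMost : ∀ {k} → (∀ j → KProp T ℓ j → j ≤ k) → 1 ≤ n ∸ ℓ →
    Σ (Subset n) λ W → IsCard ℓ W × Connected W (Induced T W) × DiamAtMost W (Induced T W) (2 * k + 3)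
  connected-card-diamAtMost {k} maximal pos
    with anySubset? (λ W → (∣ W ∣ ≟ℕ n ∸ ℓ) ×-dec diamAtMost? (induced? T W) (2 * k + 3))
  ... | yes (W , card , near) = W , card , diamAtMost⇒connected near , near
  ... | no none =
    ⊥-elim (1+n≰n (maximal (suc k) (next-evine-exists {k = k} pos none , next-evines-small {k = k} pos none)))

lemma2p11 : (n ℓ k : ℕ) → 1 ≤ ℓ → (T : Graph n) → IsTreeGraph T → IsK T ℓ k
    → ((W : Subset n) → IsCard ℓ W → Connected W (Induced T W)
    → DiamAtLeast W (Induced T W) (2 * k + 2))
    × Σ (Subset n) (λ W → IsCard ℓ W × Connected W (Induced T W)
    × DiamAtMost W (Induced T W) (2 * k + 3))
lemma2p11 n ℓ k _ T tree (k-prop , maximal) =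
  (λ W card _ → cards-diamAtLeast ℓ tree {k} k-prop W card) ,
  connected-card-diamAtMost ℓ tree maximal (KProp⇒1≤n∸ℓ ℓ tree {k} k-prop)
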